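{- Let $D$ be a finite digraph, let $U_0=\emptyset$, and let $U_1,\ldots,U_m$ be the coresets of $D$. For $0\le i\le m$ let $D_i$ be the subdigraph of $D$ with vertex set $U_i\cup\alpha(U_i)$ and edge set $[U_i,\alpha(U_i)]$. Then $D_0,\ldots,D_m$ decompose $D$: they are pairwise edge-disjoint and their union is $D$.
   Context: Digraphs are finite; loops are allowed, multiple edges are not. A sink is a vertex with no successors; a source is a vertex with no predecessors. For a vertex $v$, $\alpha(v)$ is the set of successors and $\beta(v)$ the set of predecessors of $v$; for nonempty $S\subseteq V(D)$, $\alpha(S)=\bigcup_{v\in S}\alpha(v)$, $\beta(S)=\bigcup_{v\in S}\beta(v)$; by convention $\alpha(\emptyset)$ is the set of sources and $\beta(\emptyset)$ the set of sinks. A coreset of $D$ is either (1) the set of all sinks of $D$ (the trivial coreset), or (2) a minimal nonempty set $U\subseteq V(D)$ with $\beta(\alpha(U))=U$. For $A,B\subseteq V(D)$, $[A,B]$ denotes the set of edges of $D$ with tail in $A$ and head in $B$. A decomposition of a digraph is a set of pairwise edge-disjoint subgraphs whose union is the digraph (so every vertex and every edge lies in some subgraph). -}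

module Defs where

open import Data.Nat using (ℕ; suc)
open import Data.Fin using (Fin; zero; suc)
open import Data.Fin.Subset using (Subset; _∈_; _∉_; _⊆_; ⊥)
open import Data.Bool using (Bool; T)
open import Data.Product using (Σ; ∃; _×_; _,_)
open import Data.Sum using (_⊎_)
open import Relation.Nullary using (¬_)
open import Relation.Binary.PropositionalEquality using (_≡_; _≢_)
open import Function.Bundles using (_⇔_)

-- A finite digraph on vertex set Fin n, given by its adjacency relation
-- (loops allowed, no multiple edges).
record Digraph : Set where
  field
    n   : ℕ
    adj : Fin n → Fin n → Bool

module _ (D : Digraph) where
  open Digraph D

  Edge : Fin n → Fin n → Set
  Edge u v = T (adj u v)

  IsSink : Fin n → Set
  IsSink v = ∀ w → ¬ Edge v w

  IsSource : Fin n → Set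
  IsSource v = ∀ w → ¬ Edge w v

  Nonempty : Subset n → Set
  Nonempty U = ∃ λ v → v ∈ U

  -- v ∈ α(U): α(∅) = sources; otherwise the union of successors.
  InAlpha : Subset n → Fin n → Set
  InAlpha U v = ((∀ u → u ∉ U) × IsSource v) ⊎ (∃ λ u → u ∈ U × Edge u v)

  -- v ∈ β(P) for a vertex set P given as a predicate:
  -- β(∅) = sinks; otherwise the union of predecessors.
  InBeta : (Fin n → Set) → Fin n → Set
  InBeta P v = ((∀ w → ¬ P w) × IsSink v) ⊎ (∃ λ w → P w × Edge v w)

  BetaAlphaFixed : Subset n → Set
  BetaAlphaFixed U = ∀ v → (InBeta (InAlpha U) v ⇔ v ∈ U)

  IsCoreset : Subset n → Set
  IsCoreset U =
    (∀ v → (v ∈ U ⇔ IsSink v))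
    ⊎ (Nonempty U × BetaAlphaFixed U
        × (∀ U′ → Nonempty U′ → U′ ⊆ U → BetaAlphaFixed U′ → U′ ≡ U))

  record Subgraph : Set₁ where
    field
      Vert  : Fin n → Set
      EdgeS : Fin n → Fin n → Set

  open Subgraph

  starGraph : Subset n → Subgraph
  starGraph U = record
    { Vert  = λ v → v ∈ U ⊎ InAlpha U v
    ; EdgeS = λ u v → Edge u v × u ∈ U × InAlpha U v }

  IsSubgraph : Subgraph → Set
  IsSubgraph H = ∀ u v → EdgeS H u v → Edge u v × Vert H u × Vert H v

  IsDecomposition : {k : ℕ} → (Fin k → Subgraph) → Set
  IsDecomposition {k} H =
    (∀ i → IsSubgraph (H i))
    × (∀ i j → i ≢ j → ∀ u v → ¬ (EdgeS (H i) u v × EdgeS (H j) u v))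
    × (∀ v → ∃ λ i → Vert (H i) v)
    × (∀ u v → Edge u v → ∃ λ i → EdgeS (H i) u v)

  withEmpty : {m : ℕ} → (Fin m → Subset n) → Fin (suc m) → Subset n
  withEmpty U zero    = ⊥
  withEmpty U (suc i) = U i

-- A vertex set W containing a non-sink satisfies β(α(W)) = W exactly when it is
-- saturated: every vertex of W has a successor, and any vertex sharing a successor
-- with a vertex of W lies in W. Saturated sets are closed under intersection and
-- under removing a saturated subset, so the non-trivial coresets are the minimal
-- saturated sets. Any two of them through a common non-sink coincide, and since the
-- set of all non-sinks is saturated, descending along ⊂ yields one through every
-- non-sink. An edge u → v therefore
-- lies in [C, α(C)] for exactly one coreset C, namely the one through u, and every
-- vertex is either a source, hence in α(∅), or the head of such an edge.
module Submission where

open import Defs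
open import Data.Nat using (ℕ)
open import Data.Fin using (Fin; zero; suc)
open import Data.Fin.Subset using (Subset; _∈_; _∉_; _⊆_; _⊂_; _∩_; ∁)
open import Data.Fin.Subset.Properties
  using (_∈?_; _⊂?_; anySubset?; ⊆-antisym; p∩q⊆p; p∩q⊆q; x∈p∩q⁺; x∈p∩q⁻; x∈∁p⇒x∉p; x∉p⇒x∈∁p; ∉⊥)
open import Data.Fin.Subset.Induction using (⊂-wellFounded)
open import Data.Fin.Properties using (any?; all?)
open import Data.Bool using (T?)
open import Data.Vec using (tabulate)
open import Data.Vec.Properties using (lookup⇒[]=; []=⇒lookup; lookup∘tabulate)
open import Data.Product using (∃; _×_; _,_; proj₁; proj₂)
open import Data.Sum using (inj₁; inj₂)
open import Data.Empty using (⊥-elim)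
open import Induction.WellFounded using (Acc; acc)
open import Relation.Nullary using (¬_; Dec; yes; no; does)
open import Relation.Nullary.Decidable using (_×-dec_; _→-dec_; dec-true)
open import Relation.Binary.PropositionalEquality using (_≡_; _≢_; refl; sym; trans; cong)
open import Function.Bundles using (Equivalence; mk⇔)

module _ {n : ℕ} {P : Fin n → Set} (P? : ∀ v → Dec (P v)) where

  subsetOf : Subset n
  subsetOf = tabulate (λ v → does (P? v))

  ∈subsetOf⁺ : ∀ {v} → P v → v ∈ subsetOf
  ∈subsetOf⁺ {v} p = lookup⇒[]= v subsetOf (trans (lookup∘tabulate _ v) (dec-true (P? v) p))

  ∈subsetOf⁻ : ∀ {v} → v ∈ subsetOf → P v
  ∈subsetOf⁻ {v} v∈ with P? v | trans (sym (lookup∘tabulate (λ v → does (P? v)) v)) ([]=⇒lookup v∈)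
  ... | yes p | _ = p
  ... | no _  | ()

p∩∁q⊂p : ∀ {n} {p q : Subset n} {x} → x ∈ p → x ∈ q → p ∩ ∁ q ⊂ p
p∩∁q⊂p {p = p} {q} x∈p x∈q =
  p∩q⊆p p (∁ q) , _ , x∈p , λ x∈p∩∁q → x∈∁p⇒x∉p (proj₂ (x∈p∩q⁻ p (∁ q) x∈p∩∁q)) x∈q

module _ (D : Digraph) where
  open Digraph D

  HasSuccessor : Fin n → Set
  HasSuccessor v = ∃ λ w → Edge D v w

  edge? : ∀ u v → Dec (Edge D u v)
  edge? u v = T? (adj u v)

  hasSuccessor? : ∀ v → Dec (HasSuccessor v)
  hasSuccessor? v = any? (edge? v)

  CommonSuccessorClosed : Subset n → Set
  CommonSuccessorClosed W = ∀ z w v → z ∈ W → Edge D z w → Edge D v w → v ∈ W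

  Saturated : Subset n → Set
  Saturated W = Nonempty D W × (∀ v → v ∈ W → HasSuccessor v) × CommonSuccessorClosed W

  saturated? : ∀ W → Dec (Saturated W)
  saturated? W =
    any? (_∈? W)
    ×-dec all? (λ v → v ∈? W →-dec hasSuccessor? v)
    ×-dec all? (λ z → all? λ w → all? λ v →
                  z ∈? W →-dec edge? z w →-dec edge? v w →-dec v ∈? W)

  saturated⇒fixed : ∀ {W} → Saturated W → BetaAlphaFixed D W
  saturated⇒fixed {W} ((z , z∈W) , successor , closed) v = mk⇔ to from
    where
    to : InBeta D (InAlpha D W) v → v ∈ W
    to (inj₁ (noneInα , _)) =
      let (w , e) = successor z z∈W in ⊥-elim (noneInα w (inj₂ (z , z∈W , e)))
    to (inj₂ (w , inj₁ (W-empty , _) , _)) = ⊥-elim (W-empty z z∈W)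
    to (inj₂ (w , inj₂ (z′ , z′∈W , e₁) , e₂)) = closed z′ w v z′∈W e₁ e₂
    from : v ∈ W → InBeta D (InAlpha D W) v
    from v∈W = let (w , e) = successor v v∈W in inj₂ (w , inj₂ (v , v∈W , e) , e)

  fixed⇒saturated : ∀ {W u} → u ∈ W → HasSuccessor u → BetaAlphaFixed D W → Saturated W
  fixed⇒saturated {W} {u} u∈W (w₀ , e₀) fixed = (u , u∈W) , successor , closed
    where
    successor : ∀ v → v ∈ W → HasSuccessor v
    successor v v∈W with Equivalence.from (fixed v) v∈W
    ... | inj₁ (noneInα , _) = ⊥-elim (noneInα w₀ (inj₂ (u , u∈W , e₀)))
    ... | inj₂ (w , _ , e)   = w , e
    closed : CommonSuccessorClosed W
    closed z w v z∈W e₁ e₂ = Equivalence.to (fixed v) (inj₂ (w , inj₂ (z , z∈W , e₁) , e₂))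

  saturated-∩ : ∀ {W V u} → u ∈ W → u ∈ V → Saturated W → Saturated V → Saturated (W ∩ V)
  saturated-∩ {W} {V} {u} u∈W u∈V (_ , successor , closedW) (_ , _ , closedV) =
    (u , x∈p∩q⁺ (u∈W , u∈V)) ,
    (λ v v∈W∩V → successor v (proj₁ (x∈p∩q⁻ W V v∈W∩V))) ,
    λ z w v z∈W∩V e₁ e₂ → let (z∈W , z∈V) = x∈p∩q⁻ W V z∈W∩V in
      x∈p∩q⁺ (closedW z w v z∈W e₁ e₂ , closedV z w v z∈V e₁ e₂)

  saturated-∖ : ∀ {W V u} → u ∈ W → u ∉ V → Saturated W → Saturated V → Saturated (W ∩ ∁ V)
  saturated-∖ {W} {V} {u} u∈W u∉V (_ , successor , closedW) (_ , _ , closedV) =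
    (u , x∈p∩q⁺ (u∈W , x∉p⇒x∈∁p u∉V)) ,
    (λ v v∈W∖V → successor v (proj₁ (x∈p∩q⁻ W (∁ V) v∈W∖V))) ,
    λ z w v z∈W∖V e₁ e₂ → let (z∈W , z∈∁V) = x∈p∩q⁻ W (∁ V) z∈W∖V in
      x∈p∩q⁺ (closedW z w v z∈W e₁ e₂ ,
              x∉p⇒x∈∁p λ v∈V → x∈∁p⇒x∉p z∈∁V (closedV v w z v∈V e₂ e₁))

  MinimalSaturatedAt : Fin n → Subset n → Set
  MinimalSaturatedAt u W = Saturated W × u ∈ W × (∀ V → V ⊂ W → Saturated V → u ∉ V)

  minimalSaturatedAt-exists : ∀ {W u} → Acc _⊂_ W → Saturated W → u ∈ W → ∃ (MinimalSaturatedAt u)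
  minimalSaturatedAt-exists {W} {u} (acc smaller) sat u∈W
    with anySubset? (λ V → V ⊂? W ×-dec saturated? V ×-dec u ∈? V)
  ... | yes (V , V⊂W , satV , u∈V) = minimalSaturatedAt-exists (smaller V⊂W) satV u∈V
  ... | no none = W , sat , u∈W , λ V V⊂W satV u∈V → none (V , V⊂W , satV , u∈V)

  MinimalFixed : Subset n → Set
  MinimalFixed C = ∀ V → Nonempty D V → V ⊆ C → BetaAlphaFixed D V → V ≡ C

  minimalSaturatedAt⇒coreset : ∀ {u W} → MinimalSaturatedAt u W → IsCoreset D W
  minimalSaturatedAt⇒coreset {u} {W} (sat@(W≠∅ , successor , _) , u∈W , minimal) =
    inj₂ (W≠∅ , saturated⇒fixed sat , minimalFixed)
    where
    minimalFixed : MinimalFixed W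
    minimalFixed V (y , y∈V) V⊆W fixed = ⊆-antisym V⊆W W⊆V
      where
      satV : Saturated V
      satV = fixed⇒saturated y∈V (successor y (V⊆W y∈V)) fixed
      W⊆V : W ⊆ V
      W⊆V {x} x∈W with x ∈? V | u ∈? V
      ... | yes x∈V | _       = x∈V
      ... | no x∉V  | yes u∈V = ⊥-elim (minimal V (V⊆W , x , x∈W , x∉V) satV u∈V)
      ... | no _    | no u∉V  =
        ⊥-elim (minimal (W ∩ ∁ V) (p∩∁q⊂p (V⊆W y∈V) y∈V) (saturated-∖ u∈W u∉V sat satV)
                        (x∈p∩q⁺ (u∈W , x∉p⇒x∈∁p u∉V)))

  nonSinks : Subset n
  nonSinks = subsetOf hasSuccessor?

  saturated-nonSinks : ∀ {u} → HasSuccessor u → Saturated nonSinks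
  saturated-nonSinks {u} hasSucc =
    (u , ∈subsetOf⁺ hasSuccessor? hasSucc) ,
    (λ v → ∈subsetOf⁻ hasSuccessor?) ,
    λ _ w _ _ _ e → ∈subsetOf⁺ hasSuccessor? (w , e)

  coreset-through : ∀ {u} → HasSuccessor u → ∃ λ C → IsCoreset D C × u ∈ C
  coreset-through hasSucc
    with minimalSaturatedAt-exists (⊂-wellFounded nonSinks) (saturated-nonSinks hasSucc)
                                   (∈subsetOf⁺ hasSuccessor? hasSucc)
  ... | C , minimal@(_ , u∈C , _) = C , minimalSaturatedAt⇒coreset minimal , u∈C

  coreset-nontrivial : ∀ {C u} → IsCoreset D C → u ∈ C → HasSuccessor u
    → Nonempty D C × BetaAlphaFixed D C × MinimalFixed C
  coreset-nontrivial {u = u} (inj₁ sinks) u∈C (w , e) = ⊥-elim (Equivalence.to (sinks u) u∈C w e)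
  coreset-nontrivial (inj₂ nontrivial) _ _ = nontrivial

  coreset-unique : ∀ {C C′ u} → IsCoreset D C → IsCoreset D C′ → u ∈ C → u ∈ C′ → HasSuccessor u
    → C ≡ C′
  coreset-unique {C} {C′} coreset coreset′ u∈C u∈C′ hasSucc
    with coreset-nontrivial coreset u∈C hasSucc | coreset-nontrivial coreset′ u∈C′ hasSucc
  ... | _ , fixed , minimal | _ , fixed′ , minimal′ =
    let sat∩ = saturated-∩ u∈C u∈C′ (fixed⇒saturated u∈C hasSucc fixed)
                                    (fixed⇒saturated u∈C′ hasSucc fixed′)
        fixed∩ = saturated⇒fixed sat∩
    in trans (sym (minimal (C ∩ C′) (proj₁ sat∩) (p∩q⊆p C C′) fixed∩))
             (minimal′ (C ∩ C′) (proj₁ sat∩) (p∩q⊆q C C′) fixed∩)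

  starGraph-isSubgraph : ∀ U → IsSubgraph D (starGraph D U)
  starGraph-isSubgraph U u v (e , u∈U , v∈αU) = e , inj₁ u∈U , inj₂ v∈αU

theorem3 : (D : Digraph) (m : ℕ) (U : Fin m → Subset (Digraph.n D))
    → (∀ i j → i ≢ j → U i ≢ U j)
    → (∀ i → IsCoreset D (U i))
    → (∀ W → IsCoreset D W → ∃ λ i → U i ≡ W)
    → IsDecomposition D (λ i → starGraph D (withEmpty D U i))
theorem3 D m U distinct coreset complete =
  (λ i → starGraph-isSubgraph D (withEmpty D U i)) , disjoint , coversVertices , coversEdges
  where
  H = λ i → starGraph D (withEmpty D U i)

  disjoint : ∀ i j → i ≢ j → ∀ u v → ¬ (Subgraph.EdgeS (H i) u v × Subgraph.EdgeS (H j) u v)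
  disjoint zero    _       _   _ _ ((_ , u∈∅ , _) , _)           = ∉⊥ u∈∅
  disjoint (suc i) zero    _   _ _ (_ , (_ , u∈∅ , _))           = ∉⊥ u∈∅
  disjoint (suc i) (suc j) i≢j u v ((e , u∈Ui , _) , (_ , u∈Uj , _)) =
    distinct i j (λ i≡j → i≢j (cong suc i≡j))
      (coreset-unique D (coreset i) (coreset j) u∈Ui u∈Uj (v , e))

  coversEdges : ∀ u v → Edge D u v → ∃ λ i → Subgraph.EdgeS (H i) u v
  coversEdges u v e with coreset-through D (v , e)
  ... | C , isCoreset , u∈C with complete C isCoreset
  ... | i , refl = suc i , e , u∈C , inj₂ (u , u∈C , e)

  coversVertices : ∀ v → ∃ λ i → Subgraph.Vert (H i) v
  coversVertices v with any? (λ w → edge? D w v)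
  ... | yes (w , e) = let (i , _ , _ , v∈αUi) = coversEdges w v e in i , inj₂ v∈αUi
  ... | no noPred   = zero , inj₂ (inj₁ ((λ _ → ∉⊥) , λ w e → noPred (w , e)))
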